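{- Let $\mathfrak O=(\mathcal O,\mathcal F,\alpha,\epsilon,\iota,o)$ be an ologism and let $\sigma$ be an $\mathfrak O$-proposition. If $\sigma$ is a logical consequence of $\mathfrak O$ (i.e. $\mathfrak O\vdash\sigma$), then $\sigma$ is a semantical consequence of $\mathfrak O$ (i.e. $\mathfrak O\models\sigma$: every model of $\mathfrak O$ satisfies $\sigma$).
   Context: Graphs: a graph has a set of nodes, a set of arcs, and source/target functions; a path from $A$ to $B$ is a finite (possibly empty) sequence of consecutive arcs; two paths are parallel if they have the same start and end nodes. A diagram in a graph $\mathcal G$ is a graph homomorphism from some graph into $\mathcal G$. For a graph $\mathcal G$, $\mathcal G^*$ is the free category on $\mathcal G$ (morphisms are paths, composition is concatenation). For a set $\mathcal F$ of diagrams in $\mathcal G$, $\sim_{\mathcal F}$ is the smallest congruence relation on $\mathcal G^*$ (an equivalence relation relating only parallel morphisms and stable under pre- and post-composition) containing every pair of parallel paths lying in the image of some diagram of $\mathcal F$. Ologism: $\mathfrak O=(\mathcal O,\mathcal F,\alpha,\epsilon,\iota,o)$ where $\mathcal O$ is a graph with a distinguished node $\bullet$; $\mathcal O_\bullet$ is the graph obtained by deleting $\bullet$ and all arcs with source or target $\bullet$; nodes of $\mathcal O_\bullet$ are called types and arcs of $\mathcal O_\bullet$ aspects, some aspects carrying the label "is"; $\mathcal F$ is a set of diagrams in $\mathcal O_\bullet$ (the facts), so $(\mathcal O_\bullet,\mathcal F)$ is an olog (linear sketch). For types $A,B$: $\alpha$ is a set of universal affirmative premisses $\mathbf A_{AB}$,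 each given by an aspect $A\xrightarrow{\text{is}}B$; $\epsilon$ is a set of universal negative premisses $\mathbf E_{AB}$, each given by arcs $A\to\bullet\leftarrow B$ of $\mathcal O$; $\iota$ is a set of particular affirmative premisses $\mathbf I_{AB}$, each given by arcs $A\leftarrow\bullet\to B$; $o$ is a set of particular negative premisses $\mathbf O_{AB}$, each given by arcs $A\leftarrow\bullet\to\bullet\leftarrow B$. Logical theory: $\alpha^*$ is the set of propositions $\mathbf A_{AC}$ derivable from $\alpha$ together with the identity premisses $\mathbf A_{AA}$ (for every type $A$) by the rule: from $\mathbf A_{AB}$ and $\mathbf A_{BC}$ infer $\mathbf A_{AC}$. $\epsilon^*$ is the set of $\mathbf E$-propositions derivable from $\epsilon\cup\alpha^*$ by the rules: from $\mathbf E_{AB}$ and $\mathbf A_{CB}$ infer $\mathbf E_{AC}$; from $\mathbf A_{AB}$ and $\mathbf E_{BC}$ infer $\mathbf E_{AC}$. $\iota^*$ is the set of $\mathbf I$-propositions derivable from $\iota\cup\alpha^*$ by: from $\mathbf I_{AB}$ and $\mathbf A_{BC}$ infer $\mathbf I_{AC}$; from $\mathbf A_{BA}$ and $\mathbf I_{BC}$ infer $\mathbf I_{AC}$. $o^*$ is the set of $\mathbf O$-propositions derivable from $\epsilon^*\cup\iota^*\cup\alpha^*\cup o$ by: from $\mathbf I_{AB}$ and $\mathbf E_{BC}$ infer $\mathbf O_{AC}$; from $\mathbf A_{BA}$ and $\mathbf O_{BC}$ infer $\mathbf O_{AC}$; from $\mathbf O_{AB}$ and $\mathbf A_{CB}$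 infer $\mathbf O_{AC}$. $\mathfrak O$-propositions: an $\mathfrak O$-equality is a formal equation $f_1;\dots;f_n=g_1;\dots;g_m$ between two parallel paths of $\mathcal O_\bullet$; an $\mathfrak O$-categorical proposition is $\mathbf X_{AB}$ with $\mathbf X\in\{\mathbf A,\mathbf E,\mathbf I,\mathbf O\}$ and $A,B$ types. Logical consequence $\mathfrak O\vdash\sigma$ means: for an equality, the two paths are related by $\sim_{\mathcal F}$; for a categorical proposition, $\sigma\in\alpha^*\cup\epsilon^*\cup\iota^*\cup o^*$. Models: a model of $\mathfrak O$ is a graph homomorphism $\mathcal M:\mathcal O_\bullet\to\mathbf{Sets}$ such that every diagram in $\mathcal F$ becomes commutative, every aspect $A\xrightarrow{\text{is}}B$ is interpreted as the inclusion map $\mathcal MA\hookrightarrow\mathcal MB$ (so $\mathcal MA\subseteq\mathcal MB$), and: for $\mathbf E_{AB}\in\epsilon$, $\mathcal MA\cap\mathcal MB=\emptyset$; for $\mathbf I_{AB}\in\iota$, $\mathcal MA\cap\mathcal MB\neq\emptyset$; for $\mathbf O_{AB}\in o$, $\mathcal MA\not\subseteq\mathcal MB$. A model $\mathcal M$ satisfies an equality $f_1;\dots;f_n=g_1;\dots;g_m$ if the composites of $\mathcal Mf_1,\dots,\mathcal Mf_n$ and of $\mathcal Mg_1,\dots,\mathcal Mg_m$ are equal functions; it satisfies $\mathbf A_{AB}$, $\mathbf E_{AB}$, $\mathbf I_{AB}$, $\mathbf O_{AB}$ respectively if $\mathcal MA\subseteq\mathcal MB$, $\mathcal MA\cap\mathcal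 MB=\emptyset$, $\mathcal MA\cap\mathcal MB\neq\emptyset$, $\mathcal MA\not\subseteq\mathcal MB$. $\mathfrak O\models\sigma$ means every model of $\mathfrak O$ satisfies $\sigma$. -}

module Defs where

open import Data.Empty using (⊥)
open import Data.Product using (Σ; _×_)
open import Relation.Binary.PropositionalEquality using (_≡_)
open import Relation.Nullary using (¬_)

-- Graphs (arcs given as a family indexed by source and target node;
-- equivalent to a set of arcs with source/target functions).

record Graph : Set₁ where
  field
    Node : Set
    Arc  : Node → Node → Set

open Graph public

data Path (G : Graph) : Node G → Node G → Set where
  nil  : ∀ {x} → Path G x x
  cons : ∀ {x y z} → Arc G x y → Path G y z → Path G x z

_++_ : ∀ {G x y z} → Path G x y → Path G y z → Path G x z
nil ++ q = q
cons a p ++ q = cons a (p ++ q)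

record Hom (D G : Graph) : Set where
  field
    onNode : Node D → Node G
    onArc  : ∀ {x y} → Arc D x y → Arc G (onNode x) (onNode y)

open Hom public

mapPath : ∀ {D G} (h : Hom D G) {x y} → Path D x y → Path G (onNode h x) (onNode h y)
mapPath h nil = nil
mapPath h (cons a p) = cons (onArc h a) (mapPath h p)

-- The graph 𝒪 with distinguished node • is given as:
-- the graph 𝒪_• (types and aspects), plus the arcs of 𝒪 incident to •:
-- arcs A → • (ToB A), arcs • → A (FromB A), and loops • → • (Loop).

record Ologism : Set₁ where
  field
    𝒪• : Graph
    ToB   : Node 𝒪• → Set
    FromB : Node 𝒪• → Set
    Loop  : Set
    -- the label "is" on aspects
    IsLabelled : ∀ {A B} → Arc 𝒪• A B → Set
    Fact  : Set
    shape : Fact → Graph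
    diag  : (F : Fact) → Hom (shape F) 𝒪•
    α  : ∀ {A B} → Arc 𝒪• A B → Set
    α-is : ∀ {A B} (f : Arc 𝒪• A B) → α f → IsLabelled f
    ε  : ∀ {A B} → ToB A → ToB B → Set
    ι  : ∀ {A B} → FromB A → FromB B → Set
    o  : ∀ {A B} → FromB A → Loop → ToB B → Set

  Type : Set
  Type = Node 𝒪•

open Ologism public

-- composite of the interpretation of a path, in diagrammatic order f₁ ; … ; fₙ
evalPath : ∀ {G : Graph} {U : Set} → (∀ {A B} → Arc G A B → U → U) →
           ∀ {A B} → Path G A B → U → U
evalPath fun nil u = u
evalPath fun (cons f p) u = evalPath fun p (fun f u)

module _ (𝔒 : Ologism) where

  data _∼_ : ∀ {A B : Type 𝔒} → Path (𝒪• 𝔒) A B → Path (𝒪• 𝔒) A B → Set where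
    gen   : (F : Fact 𝔒) {x y : Node (shape 𝔒 F)} (p q : Path (shape 𝔒 F) x y) →
            mapPath (diag 𝔒 F) p ∼ mapPath (diag 𝔒 F) q
    ∼refl  : ∀ {A B} {p : Path (𝒪• 𝔒) A B} → p ∼ p
    ∼sym   : ∀ {A B} {p q : Path (𝒪• 𝔒) A B} → p ∼ q → q ∼ p
    ∼trans : ∀ {A B} {p q r : Path (𝒪• 𝔒) A B} → p ∼ q → q ∼ r → p ∼ r
    ∼pre   : ∀ {A B C} (r : Path (𝒪• 𝔒) C A) {p q : Path (𝒪• 𝔒) A B} →
             p ∼ q → (r ++ p) ∼ (r ++ q)
    ∼post  : ∀ {A B C} (s : Path (𝒪• 𝔒) B C) {p q : Path (𝒪• 𝔒) A B} →
             p ∼ q → (p ++ s) ∼ (q ++ s)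

  data A* : Type 𝔒 → Type 𝔒 → Set where
    A-prem  : ∀ {A B} (f : Arc (𝒪• 𝔒) A B) → α 𝔒 f → A* A B
    A-id    : ∀ {A} → A* A A
    A-trans : ∀ {A B C} → A* A B → A* B C → A* A C

  data E* : Type 𝔒 → Type 𝔒 → Set where
    E-prem : ∀ {A B} (e₁ : ToB 𝔒 A) (e₂ : ToB 𝔒 B) → ε 𝔒 e₁ e₂ → E* A B
    E-r1   : ∀ {A B C} → E* A B → A* C B → E* A C
    E-r2   : ∀ {A B C} → A* A B → E* B C → E* A C

  data I* : Type 𝔒 → Type 𝔒 → Set where
    I-prem : ∀ {A B} (i₁ : FromB 𝔒 A) (i₂ : FromB 𝔒 B) → ι 𝔒 i₁ i₂ → I* A B
    I-r1   : ∀ {A B C} → I* A B → A* B C → I* A C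
    I-r2   : ∀ {A B C} → A* B A → I* B C → I* A C

  data O* : Type 𝔒 → Type 𝔒 → Set where
    O-prem : ∀ {A B} (j₁ : FromB 𝔒 A) (l : Loop 𝔒) (j₂ : ToB 𝔒 B) → o 𝔒 j₁ l j₂ → O* A B
    O-r1   : ∀ {A B C} → I* A B → E* B C → O* A C
    O-r2   : ∀ {A B C} → A* B A → O* B C → O* A C
    O-r3   : ∀ {A B C} → O* A B → A* C B → O* A C

  data Proposition : Set where
    equality : ∀ {A B} → Path (𝒪• 𝔒) A B → Path (𝒪• 𝔒) A B → Proposition
    𝐀 𝐄 𝐈 𝐎 : Type 𝔒 → Type 𝔒 → Proposition

  ⊢ : Proposition → Set
  ⊢ (equality p q) = p ∼ q
  ⊢ (𝐀 A B) = A* A B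
  ⊢ (𝐄 A B) = E* A B
  ⊢ (𝐈 A B) = I* A B
  ⊢ (𝐎 A B) = O* A B

  -- All sets 𝓜A are taken as subsets of an ambient set U
  -- (membership predicate Ext A), so that ∩ and ⊆ make sense; a function
  -- 𝓜A → 𝓜B is given by a map U → U sending 𝓜A into 𝓜B, and two such
  -- functions are equal when they agree on 𝓜A.
  record Model : Set₁ where
    field
      U    : Set
      Ext  : Type 𝔒 → U → Set
      fun  : ∀ {A B} → Arc (𝒪• 𝔒) A B → U → U
      fun-into : ∀ {A B} (f : Arc (𝒪• 𝔒) A B) (u : U) → Ext A u → Ext B (fun f u)

      commutes : (F : Fact 𝔒) {x y : Node (shape 𝔒 F)} (p q : Path (shape 𝔒 F) x y) →
                 (u : U) → Ext (onNode (diag 𝔒 F) x) u →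
                 evalPath fun (mapPath (diag 𝔒 F) p) u ≡ evalPath fun (mapPath (diag 𝔒 F) q) u
      is-inclusion : ∀ {A B} (f : Arc (𝒪• 𝔒) A B) → IsLabelled 𝔒 f →
                     (u : U) → Ext A u → fun f u ≡ u
      ε-sound : ∀ {A B} (e₁ : ToB 𝔒 A) (e₂ : ToB 𝔒 B) → ε 𝔒 e₁ e₂ →
                (u : U) → Ext A u → Ext B u → ⊥
      ι-sound : ∀ {A B} (i₁ : FromB 𝔒 A) (i₂ : FromB 𝔒 B) → ι 𝔒 i₁ i₂ →
                Σ U (λ u → Ext A u × Ext B u)
      o-sound : ∀ {A B} (j₁ : FromB 𝔒 A) (l : Loop 𝔒) (j₂ : ToB 𝔒 B) → o 𝔒 j₁ l j₂ →
                ¬ ((u : U) → Ext A u → Ext B u)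

  Satisfies : Model → Proposition → Set
  Satisfies M (equality {A} p q) = (u : Model.U M) → Model.Ext M A u → evalPath (Model.fun M) p u ≡ evalPath (Model.fun M) q u
  Satisfies M (𝐀 A B) = (u : Model.U M) → Model.Ext M A u → Model.Ext M B u
  Satisfies M (𝐄 A B) = (u : Model.U M) → Model.Ext M A u → Model.Ext M B u → ⊥
  Satisfies M (𝐈 A B) = Σ (Model.U M) (λ u → Model.Ext M A u × Model.Ext M B u)
  Satisfies M (𝐎 A B) = ¬ ((u : Model.U M) → Model.Ext M A u → Model.Ext M B u)

  ⊨ : Proposition → Set₁
  ⊨ σ = (M : Model) → Satisfies M σ

module Submission where

-- First, two general facts about interpreting paths of an arbitrary graph by
-- maps on an ambient set: evaluation turns concatenation into composition,
-- and maps that respect a typing of the ambient set send well-typed elements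
-- along a whole path.  These give soundness of the congruence ∼_𝓕: the
-- generating pairs commute by definition of a model, and closure under pre-
-- and post-composition follows from the composition law.  For categorical
-- propositions, α* is sound because "is"-aspects are inclusions, and the
-- derived rules for ε*, ι*, o* are classical syllogisms, each of which is a
-- one-line set-theoretic fact once its premisses hold in the model.

open import Defs
open import Data.Empty using (⊥)
open import Data.Product using (Σ; _×_; _,_)
open import Relation.Binary.PropositionalEquality
  using (_≡_; refl; sym; trans; cong; subst; module ≡-Reasoning)

module PathEvaluation {G : Graph} {U : Set}
                      (fun : ∀ {A B} → Arc G A B → U → U) where

  evalPath-++ : ∀ {A B C} (p : Path G A B) (q : Path G B C) (u : U) →
                evalPath fun (p ++ q) u ≡ evalPath fun q (evalPath fun p u)
  evalPath-++ nil        q u = refl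
  evalPath-++ (cons f p) q u = evalPath-++ p q (fun f u)

  evalPath-into : (Ext : Node G → U → Set) →
                  (∀ {A B} (f : Arc G A B) (u : U) → Ext A u → Ext B (fun f u)) →
                  ∀ {A B} (p : Path G A B) (u : U) → Ext A u → Ext B (evalPath fun p u)
  evalPath-into Ext into nil        u x = x
  evalPath-into Ext into (cons f p) u x = evalPath-into Ext into p (fun f u) (into f u x)

module Soundness (𝔒 : Ologism) (M : Model 𝔒) where
  open Model M
  open PathEvaluation {G = 𝒪• 𝔒} fun

  private
    ⟦_⟧ : ∀ {A B} → Path (𝒪• 𝔒) A B → U → U
    ⟦ p ⟧ = evalPath fun p

  ∼-sound : ∀ {A B} {p q : Path (𝒪• 𝔒) A B} → _∼_ 𝔒 p q →
            (u : U) → Ext A u → ⟦ p ⟧ u ≡ ⟦ q ⟧ u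
  ∼-sound (gen F p q)  u x = commutes F p q u x
  ∼-sound ∼refl        u x = refl
  ∼-sound (∼sym h)     u x = sym (∼-sound h u x)
  ∼-sound (∼trans h k) u x = trans (∼-sound h u x) (∼-sound k u x)
  ∼-sound (∼pre r {p} {q} h) u x = begin
      ⟦ r ++ p ⟧ u      ≡⟨ evalPath-++ r p u ⟩
      ⟦ p ⟧ (⟦ r ⟧ u)   ≡⟨ ∼-sound h (⟦ r ⟧ u) (evalPath-into Ext fun-into r u x) ⟩
      ⟦ q ⟧ (⟦ r ⟧ u)   ≡⟨ sym (evalPath-++ r q u) ⟩
      ⟦ r ++ q ⟧ u      ∎
    where open ≡-Reasoning
  ∼-sound (∼post s {p} {q} h) u x = begin
      ⟦ p ++ s ⟧ u      ≡⟨ evalPath-++ p s u ⟩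
      ⟦ s ⟧ (⟦ p ⟧ u)   ≡⟨ cong ⟦ s ⟧ (∼-sound h u x) ⟩
      ⟦ s ⟧ (⟦ q ⟧ u)   ≡⟨ sym (evalPath-++ q s u) ⟩
      ⟦ q ++ s ⟧ u      ∎
    where open ≡-Reasoning

  -- 𝐀_AB ∈ α* gives 𝓜A ⊆ 𝓜B: premisses are inclusions, and ⊆ is a preorder.
  A*-sound : ∀ {A B} → A* 𝔒 A B → (u : U) → Ext A u → Ext B u
  A*-sound (A-prem f a) u x =
    subst (Ext _) (is-inclusion f (α-is 𝔒 f a) u x) (fun-into f u x)
  A*-sound A-id          u x = x
  A*-sound (A-trans h k) u x = A*-sound k u (A*-sound h u x)

  -- 𝐄_AB ∈ ε* gives 𝓜A ∩ 𝓜B = ∅ (disjointness passes to subsets).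
  E*-sound : ∀ {A B} → E* 𝔒 A B → (u : U) → Ext A u → Ext B u → ⊥
  E*-sound (E-prem e₁ e₂ e) = ε-sound e₁ e₂ e
  E*-sound (E-r1 h a) u x y = E*-sound h u x (A*-sound a u y)
  E*-sound (E-r2 a h) u x y = E*-sound h u (A*-sound a u x) y

  -- 𝐈_AB ∈ ι* gives a witness in 𝓜A ∩ 𝓜B (intersections grow with supersets).
  I*-sound : ∀ {A B} → I* 𝔒 A B → Σ U (λ u → Ext A u × Ext B u)
  I*-sound (I-prem i₁ i₂ i) = ι-sound i₁ i₂ i
  I*-sound (I-r1 h a) with I*-sound h
  ... | u , x , y = u , x , A*-sound a u y
  I*-sound (I-r2 a h) with I*-sound h
  ... | u , x , y = u , A*-sound a u x , y

  -- 𝐎_AB ∈ o* gives 𝓜A ⊈ 𝓜B.  For the rule from 𝐈_AB and 𝐄_BC, the witness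
  -- of 𝓜A ∩ 𝓜B would lie in 𝓜C if 𝓜A ⊆ 𝓜C, contradicting 𝓜B ∩ 𝓜C = ∅.
  O*-sound : ∀ {A B} → O* 𝔒 A B → ((u : U) → Ext A u → Ext B u) → ⊥
  O*-sound (O-prem j₁ l j₂ j) = o-sound j₁ l j₂ j
  O*-sound (O-r1 i e) A⊆C with I*-sound i
  ... | u , x , y = E*-sound e u y (A⊆C u x)
  O*-sound (O-r2 a h) A⊆C = O*-sound h (λ u x → A⊆C u (A*-sound a u x))
  O*-sound (O-r3 h a) A⊆C = O*-sound h (λ u x → A*-sound a u (A⊆C u x))

mainTheorem1 : (𝔒 : Ologism) (σ : Proposition 𝔒) → ⊢ 𝔒 σ → ⊨ 𝔒 σ
mainTheorem1 𝔒 (equality p q) h M = Soundness.∼-sound 𝔒 M h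
mainTheorem1 𝔒 (𝐀 A B)        h M = Soundness.A*-sound 𝔒 M h
mainTheorem1 𝔒 (𝐄 A B)        h M = Soundness.E*-sound 𝔒 M h
mainTheorem1 𝔒 (𝐈 A B)        h M = Soundness.I*-sound 𝔒 M h
mainTheorem1 𝔒 (𝐎 A B)        h M = Soundness.O*-sound 𝔒 M h
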